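{- Let $n\ge4$ and let $k$ be a positive integer with $k\le13$ and $k\notin\{1,8,11,12\}$. Set \[A=\left\lceil\frac{k+4}{4}\right\rceil,\qquad B=\left\lceil\frac{ -2+3A}{2}\right\rceil,\qquad C=k+4-3A.\] Then \[\gamma_{[k]R}(C_4\square P_n)\le 3(n-2)A+6B+2C\le\frac{3nk+5k+24n+32}{4}.\]
   Context: $C_4$ is the cycle on 4 vertices, $P_n$ the path on $n$ vertices, and $\square$ the Cartesian product. For an integer $k\ge1$ and a labeling $f:V(G)\to\{0,1,\dots,k+1\}$, let $AN(v)=\{u\in N(v): f(u)>0\}$. The labeling $f$ is a $[k]$-Roman dominating function if every vertex $v$ with $f(v)<k$ satisfies $f(N[v])\ge k+|AN(v)|$, where $N[v]=N(v)\cup\{v\}$ and $f(X)=\sum_{x\in X}f(x)$. $\gamma_{[k]R}(G)$ is the minimum of $\sum_v f(v)$ over all $[k]$-Roman dominating functions $f$ on $G$. -}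

module Defs where

open import Data.Bool using (Bool; true; false; _∧_; _∨_)
open import Data.Nat using (ℕ; zero; suc; _+_; _*_; _∸_; _≤_; _<_; _<ᵇ_; _≡ᵇ_; NonZero; _/_; _%_)
open import Data.Fin using (Fin; toℕ)
import Data.Fin.Properties as FinP
open import Data.Nat.ListAction using (sum)
open import Data.List using (List; map; length; filterᵇ; cartesianProduct; allFin)
open import Data.Product using (Σ; _×_; _,_)
open import Relation.Nullary.Decidable using (⌊_⌋)

-- A finite simple graph: vertex type, a list enumerating all vertices
-- (each exactly once), boolean equality on vertices, and a boolean
-- symmetric irreflexive adjacency relation.
record Graph : Set₁ where
  field
    V     : Set
    verts : List V
    eqV   : V → V → Bool
    adj   : V → V → Bool
open Graph public

finEq : ∀ {m} → Fin m → Fin m → Bool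
finEq a b = ⌊ a FinP.≟ b ⌋

P : ℕ → Graph
P n = record
  { V = Fin n
  ; verts = allFin n
  ; eqV = finEq
  ; adj = λ a b → (suc (toℕ a) ≡ᵇ toℕ b) ∨ (suc (toℕ b) ≡ᵇ toℕ a)
  }

C4 : Graph
C4 = record
  { V = Fin 4
  ; verts = allFin 4
  ; eqV = finEq
  ; adj = λ a b → (suc (toℕ a) % 4 ≡ᵇ toℕ b) ∨ (suc (toℕ b) % 4 ≡ᵇ toℕ a)
  }

_□_ : Graph → Graph → Graph
G □ H = record
  { V = V G × V H
  ; verts = cartesianProduct (verts G) (verts H)
  ; eqV = λ { (g , h) (g' , h') → eqV G g g' ∧ eqV H h h' }
  ; adj = λ { (g , h) (g' , h') →
        (adj G g g' ∧ eqV H h h') ∨ (eqV G g g' ∧ adj H h h') }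
  }

N : (G : Graph) → V G → List (V G)
N G v = filterᵇ (adj G v) (verts G)

fsum : {A : Set} → (A → ℕ) → List A → ℕ
fsum f X = sum (map f X)

AN-size : (G : Graph) → (V G → ℕ) → V G → ℕ
AN-size G f v = length (filterᵇ (λ u → 0 <ᵇ f u) (N G v))

IsKRDF : ℕ → (G : Graph) → (V G → ℕ) → Set
IsKRDF k G f =
  (∀ v → f v ≤ suc k) ×
  (∀ v → f v < k → k + AN-size G f v ≤ f v + fsum f (N G v))

weight : (G : Graph) → (V G → ℕ) → ℕ
weight G f = fsum f (verts G)

⌈_/_⌉ : ℕ → (b : ℕ) → .{{NonZero b}} → ℕ
⌈ a / b ⌉ = (a + (b ∸ 1)) / b

A′ : ℕ → ℕ
A′ k = ⌈ k + 4 / 4 ⌉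

-- B = ⌈(-2 + 3A)/2⌉ ; here 3A ≥ 6 so the subtraction is exact
B′ : ℕ → ℕ
B′ k = ⌈ 3 * A′ k ∸ 2 / 2 ⌉

-- C = k + 4 - 3A ; nonnegative for every k allowed in the theorem
C′ : ℕ → ℕ
C′ k = k + 4 ∸ 3 * A′ k

bound : ℕ → ℕ → ℕ
bound n k = 3 * (n ∸ 2) * A′ k + 6 * B′ k + 2 * C′ k

-- γ_{[k]R}(G) ≤ m : since γ_{[k]R}(G) is the minimum weight of a
-- [k]-RDF (one always exists, e.g. the constant k+1 labeling), the bound
-- γ_{[k]R}(G) ≤ m holds iff some [k]-RDF has weight ≤ m.
γkR≤ : ℕ → (G : Graph) → ℕ → Set
γkR≤ k G m = Σ (V G → ℕ) (λ f → IsKRDF k G f × weight G f ≤ m)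

-- Label C₄ □ Pₙ column by column. Every column has one "hole" labelled 0, and
-- the hole alternates between the two odd positions of C₄ from one column to
-- the next; the other three vertices get A in interior columns, and values
-- x (even positions) and y (the other odd position) in the two end columns. Since f(N(v)) = |AN(v)| + Σ_{u ∈ N(v)} (f(u) ∸ 1), a vertex v with
-- f(v) < k is dominated as soon as k ≤ f(v) + Σ_{u ∈ N(v)} (f(u) ∸ 1), and that
-- excess only depends on the role of v in its column and on the kinds (end or
-- interior) of its own and adjacent columns. For n ≥ 4 only five column
-- contexts occur, so domination is a finite check for each k; the weight is
-- 3A per interior column plus two end columns of weight 2x + y ≤ 3B + C.
module Submission where

open import Defs
open import Algebra.Properties.CommutativeSemigroup using (interchange; x∙yz≈y∙xz)
open import Data.Bool using (Bool; true; false; not; _∧_; _∨_; T?; if_then_else_)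
open import Data.Bool.Properties using (∧-zeroʳ; T-∨; T-≡)
open import Data.Empty using (⊥-elim)
open import Data.Fin as Fin using (Fin; zero; suc; toℕ; fromℕ<)
import Data.Fin.Properties as FinP
open import Data.List using (List; []; _∷_; _++_; map; filterᵇ; length; cartesianProduct; allFin; applyUpTo)
open import Data.List.Membership.Propositional using (_∈_)
open import Data.List.Membership.Propositional.Properties using (∈-filter⁺; ∈-allFin)
open import Data.List.Properties using (map-++; map-∘; filter-++; map-tabulate)
open import Data.List.Relation.Unary.All as All using (All)
open import Data.List.Relation.Unary.Any using (here; there)
open import Data.Maybe as Maybe using (Maybe; just; nothing; maybe)
open import Data.Nat using (ℕ; zero; suc; _+_; _*_; _∸_; _≤_; _<_; _≡ᵇ_; _<ᵇ_; _≤?_; _<?_; _≟_; z≤n; s≤s; z<s; s<s)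
open import Data.Nat.ListAction using (sum)
open import Data.Nat.ListAction.Properties using (sum-++)
open import Data.Nat.Properties
  using (≡⇒≡ᵇ; <ᵇ⇒<; <⇒<ᵇ; <-irrefl; <-trans; n<1+n; m≤n⇒m<n∨m≡n; +-commutativeSemigroup; +-assoc; +-comm;
         +-identityʳ; ≤-refl; ≤-trans; ≤-reflexive; m≤m+n; m≤n+m; +-monoˡ-≤; +-monoʳ-≤; +-mono-≤; *-monoʳ-≤;
         allUpTo?; module ≤-Reasoning)
open import Data.Nat.Tactic.RingSolver using (solve-∀)
open import Data.Product using (_×_; _,_; proj₁; proj₂)
open import Data.Sum as Sum using (_⊎_; inj₁; inj₂)
open import Function using (_∘_; id)
open import Function.Bundles using (Equivalence)
open import Relation.Binary.PropositionalEquality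
  using (_≡_; _≢_; refl; sym; trans; cong; cong₂; subst; module ≡-Reasoning)
open import Relation.Nullary using (Dec; yes; no; ¬?)
open import Relation.Nullary.Decidable using (map′; _×-dec_; _→-dec_; toWitness)

private variable
  A B : Set

fsum-++ : (f : A → ℕ) (xs ys : List A) → fsum f (xs ++ ys) ≡ fsum f xs + fsum f ys
fsum-++ f xs ys = trans (cong sum (map-++ f xs ys)) (sum-++ (map f xs) (map f ys))

fsum-map : (f : B → ℕ) (g : A → B) (xs : List A) → fsum f (map g xs) ≡ fsum (f ∘ g) xs
fsum-map f g xs = cong sum (sym (map-∘ xs))

fsum-cong : {f g : A → ℕ} → (∀ x → f x ≡ g x) → (xs : List A) → fsum f xs ≡ fsum g xs
fsum-cong f≗g []       = refl
fsum-cong f≗g (x ∷ xs) = cong₂ _+_ (f≗g x) (fsum-cong f≗g xs)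

fsum-zero : (xs : List A) → fsum (λ _ → 0) xs ≡ 0
fsum-zero []       = refl
fsum-zero (_ ∷ xs) = fsum-zero xs

fsum-+ : (f g : A → ℕ) (xs : List A) → fsum (λ x → f x + g x) xs ≡ fsum f xs + fsum g xs
fsum-+ f g []       = refl
fsum-+ f g (x ∷ xs) =
  trans (cong (f x + g x +_) (fsum-+ f g xs)) (interchange +-commutativeSemigroup (f x) (g x) _ _)

fsum-comm : (w : A → B → ℕ) (xs : List A) (ys : List B) →
  fsum (λ x → fsum (w x) ys) xs ≡ fsum (λ y → fsum (λ x → w x y) xs) ys
fsum-comm w []       ys = sym (fsum-zero ys)
fsum-comm w (x ∷ xs) ys = begin
  fsum (w x) ys + fsum (λ x → fsum (w x) ys) xs          ≡⟨ cong (fsum (w x) ys +_) (fsum-comm w xs ys) ⟩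
  fsum (w x) ys + fsum (λ y → fsum (λ x → w x y) xs) ys  ≡⟨ sym (fsum-+ (w x) _ ys) ⟩
  fsum (λ y → w x y + fsum (λ x → w x y) xs) ys          ∎
  where open ≡-Reasoning

fsum-cartesianProduct : (w : A × B → ℕ) (xs : List A) (ys : List B) →
  fsum w (cartesianProduct xs ys) ≡ fsum (λ x → fsum (λ y → w (x , y)) ys) xs
fsum-cartesianProduct w []       ys = refl
fsum-cartesianProduct w (x ∷ xs) ys = begin
  fsum w (map (x ,_) ys ++ cartesianProduct xs ys)          ≡⟨ fsum-++ w (map (x ,_) ys) _ ⟩
  fsum w (map (x ,_) ys) + fsum w (cartesianProduct xs ys)
    ≡⟨ cong₂ _+_ (fsum-map w (x ,_) ys) (fsum-cartesianProduct w xs ys) ⟩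
  fsum (λ y → w (x , y)) ys + fsum (λ x → fsum (λ y → w (x , y)) ys) xs ∎
  where open ≡-Reasoning

fsum-cartesianProduct-singletonˡ : (w : A × B → ℕ) (x : A) (ys : List B) →
  fsum w (cartesianProduct (x ∷ []) ys) ≡ fsum (λ y → w (x , y)) ys
fsum-cartesianProduct-singletonˡ w x ys = trans (fsum-cartesianProduct w (x ∷ []) ys) (+-identityʳ _)

fsum-cartesianProduct-singletonʳ : (w : A × B → ℕ) (xs : List A) (y : B) →
  fsum w (cartesianProduct xs (y ∷ [])) ≡ fsum (λ x → w (x , y)) xs
fsum-cartesianProduct-singletonʳ w []       y = refl
fsum-cartesianProduct-singletonʳ w (x ∷ xs) y = cong (w (x , y) +_) (fsum-cartesianProduct-singletonʳ w xs y)

filterᵇ-false : (xs : List A) → filterᵇ (λ _ → false) xs ≡ []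
filterᵇ-false []       = refl
filterᵇ-false (_ ∷ xs) = filterᵇ-false xs

filterᵇ-map : (p : B → Bool) (f : A → B) (xs : List A) → filterᵇ p (map f xs) ≡ map f (filterᵇ (p ∘ f) xs)
filterᵇ-map p f []       = refl
filterᵇ-map p f (x ∷ xs) with p (f x)
... | true  = cong (f x ∷_) (filterᵇ-map p f xs)
... | false = filterᵇ-map p f xs

filterᵇ-cartesianProduct : (p : A → Bool) (q : B → Bool) (xs : List A) (ys : List B) →
  filterᵇ (λ u → p (proj₁ u) ∧ q (proj₂ u)) (cartesianProduct xs ys)
    ≡ cartesianProduct (filterᵇ p xs) (filterᵇ q ys)
filterᵇ-cartesianProduct p q []       ys = refl
filterᵇ-cartesianProduct p q (x ∷ xs) ys = begin
  filterᵇ pq (map (x ,_) ys ++ cartesianProduct xs ys)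
    ≡⟨ filter-++ (T? ∘ pq) (map (x ,_) ys) _ ⟩
  filterᵇ pq (map (x ,_) ys) ++ filterᵇ pq (cartesianProduct xs ys)
    ≡⟨ cong₂ _++_ (filterᵇ-map pq (x ,_) ys) (filterᵇ-cartesianProduct p q xs ys) ⟩
  map (x ,_) (filterᵇ (λ y → p x ∧ q y) ys) ++ cartesianProduct (filterᵇ p xs) (filterᵇ q ys)
    ≡⟨ head-row ⟩
  cartesianProduct (filterᵇ p (x ∷ xs)) (filterᵇ q ys) ∎
  where
  open ≡-Reasoning
  pq = λ u → p (proj₁ u) ∧ q (proj₂ u)
  head-row : map (x ,_) (filterᵇ (λ y → p x ∧ q y) ys) ++ cartesianProduct (filterᵇ p xs) (filterᵇ q ys)
           ≡ cartesianProduct (filterᵇ p (x ∷ xs)) (filterᵇ q ys)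
  head-row with p x
  ... | true  = refl
  ... | false = cong (λ zs → map (x ,_) zs ++ cartesianProduct (filterᵇ p xs) (filterᵇ q ys)) (filterᵇ-false ys)

fsum-filterᵇ-∨ : (w : A → ℕ) (p q : A → Bool) → (∀ x → p x ∧ q x ≡ false) → (xs : List A) →
  fsum w (filterᵇ (λ x → p x ∨ q x) xs) ≡ fsum w (filterᵇ p xs) + fsum w (filterᵇ q xs)
fsum-filterᵇ-∨ w p q disjoint [] = refl
fsum-filterᵇ-∨ w p q disjoint (x ∷ xs) with p x | q x | disjoint x
... | true  | false | _ = trans (cong (w x +_) ih) (sym (+-assoc (w x) (fsum w (filterᵇ p xs)) _))
  where ih = fsum-filterᵇ-∨ w p q disjoint xs
... | false | true  | _ = trans (cong (w x +_) ih) (x∙yz≈y∙xz +-commutativeSemigroup (w x) (fsum w (filterᵇ p xs)) _)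
  where ih = fsum-filterᵇ-∨ w p q disjoint xs
... | false | false | _ = fsum-filterᵇ-∨ w p q disjoint xs

∈⇒≤fsum : (w : A → ℕ) {x : A} {xs : List A} → x ∈ xs → w x ≤ fsum w xs
∈⇒≤fsum w (here refl) = m≤m+n _ _
∈⇒≤fsum w (there x∈)  = ≤-trans (∈⇒≤fsum w x∈) (m≤n+m _ _)

∈-∈⇒≤fsum : (w : A → ℕ) {x y : A} {xs : List A} → x ∈ xs → y ∈ xs → x ≢ y → w x + w y ≤ fsum w xs
∈-∈⇒≤fsum w (here refl) (here refl) x≢y = ⊥-elim (x≢y refl)
∈-∈⇒≤fsum w (here refl) (there y∈)  _   = +-monoʳ-≤ _ (∈⇒≤fsum w y∈)
∈-∈⇒≤fsum w {x} {y} (there x∈) (here refl) _ =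
  ≤-trans (≤-reflexive (+-comm (w x) (w y))) (+-monoʳ-≤ _ (∈⇒≤fsum w x∈))
∈-∈⇒≤fsum w (there x∈)  (there y∈)  x≢y = ≤-trans (∈-∈⇒≤fsum w x∈ y∈ x≢y) (m≤n+m _ _)

fsum≡#positive+fsum-pred : (f : A → ℕ) (xs : List A) →
  fsum f xs ≡ length (filterᵇ (λ u → 0 <ᵇ f u) xs) + fsum (λ u → f u ∸ 1) xs
fsum≡#positive+fsum-pred f [] = refl
fsum≡#positive+fsum-pred f (x ∷ xs) with f x
... | zero  = fsum≡#positive+fsum-pred f xs
... | suc m = cong suc (trans (cong (m +_) (fsum≡#positive+fsum-pred f xs))
                             (x∙yz≈y∙xz +-commutativeSemigroup m (length (filterᵇ (λ u → 0 <ᵇ f u) xs)) _))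

allFin-suc : ∀ n → allFin (suc n) ≡ zero ∷ map Fin.suc (allFin n)
allFin-suc n = cong (zero ∷_) (sym (map-tabulate id Fin.suc))

fsum-allFin : ∀ n (g : ℕ → ℕ) → fsum (g ∘ toℕ) (allFin n) ≡ sum (applyUpTo g n)
fsum-allFin zero    g = refl
fsum-allFin (suc n) g = begin
  fsum (g ∘ toℕ) (allFin (suc n))                  ≡⟨ cong (fsum (g ∘ toℕ)) (allFin-suc n) ⟩
  g 0 + fsum (g ∘ toℕ) (map Fin.suc (allFin n))    ≡⟨ cong (g 0 +_) (fsum-map (g ∘ toℕ) Fin.suc (allFin n)) ⟩
  g 0 + fsum (g ∘ suc ∘ toℕ) (allFin n)            ≡⟨ cong (g 0 +_) (fsum-allFin n (g ∘ suc)) ⟩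
  g 0 + sum (applyUpTo (g ∘ suc) n)                ∎
  where open ≡-Reasoning

sum-applyUpTo-last : ∀ m (g : ℕ → ℕ) {c d} → (∀ t → t < m → g t ≡ c) → g m ≡ d →
  sum (applyUpTo g (suc m)) ≡ m * c + d
sum-applyUpTo-last zero    g g<m g-last = trans (+-identityʳ (g 0)) g-last
sum-applyUpTo-last (suc m) g {c} g<m g-last = begin
  g 0 + sum (applyUpTo (g ∘ suc) (suc m))
    ≡⟨ cong₂ _+_ (g<m 0 z<s) (sum-applyUpTo-last m (g ∘ suc) (λ t t<m → g<m (suc t) (s<s t<m)) g-last) ⟩
  c + (m * c + _)  ≡⟨ sym (+-assoc c (m * c) _) ⟩
  suc m * c + _    ∎
  where open ≡-Reasoning

≤-fsum-pred⇒KRDF-condition : ∀ k (G : Graph) (f : V G → ℕ) v →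
  k ≤ f v + fsum (λ u → f u ∸ 1) (N G v) → k + AN-size G f v ≤ f v + fsum f (N G v)
≤-fsum-pred⇒KRDF-condition k G f v k≤ = begin
  k + AN-size G f v                                     ≤⟨ +-monoˡ-≤ (AN-size G f v) k≤ ⟩
  f v + fsum (λ u → f u ∸ 1) (N G v) + AN-size G f v    ≡⟨ shuffle (f v) _ _ ⟩
  f v + (AN-size G f v + fsum (λ u → f u ∸ 1) (N G v))  ≡⟨ cong (f v +_) (sym (fsum≡#positive+fsum-pred f (N G v))) ⟩
  f v + fsum f (N G v)                                  ∎
  where
  open ≤-Reasoning
  shuffle : ∀ x s m → x + s + m ≡ x + (m + s)
  shuffle = solve-∀

∧-∧-disjoint : ∀ a b c d → a ∧ c ≡ false → (a ∧ b) ∧ (c ∧ d) ≡ false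
∧-∧-disjoint false b c     d _  = refl
∧-∧-disjoint true  b false d _  = ∧-zeroʳ b
∧-∧-disjoint true  b true  d ()

fsum-N-□ : (G H : Graph) (g : V G) (h : V H) →
  (∀ g′ → adj G g g′ ∧ eqV G g g′ ≡ false) →
  filterᵇ (eqV G g) (verts G) ≡ g ∷ [] →
  filterᵇ (eqV H h) (verts H) ≡ h ∷ [] →
  (w : V (G □ H) → ℕ) →
  fsum w (N (G □ H) (g , h)) ≡ fsum (λ g′ → w (g′ , h)) (N G g) + fsum (λ h′ → w (g , h′)) (N H h)
fsum-N-□ G H g h disjoint G-unique H-unique w = begin
  fsum w (filterᵇ (λ u → along u ∨ within u) (cartesianProduct (verts G) (verts H)))
    ≡⟨ fsum-filterᵇ-∨ w along within along∧within≡false (cartesianProduct (verts G) (verts H)) ⟩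
  fsum w (filterᵇ along (cartesianProduct (verts G) (verts H)))
    + fsum w (filterᵇ within (cartesianProduct (verts G) (verts H)))
    ≡⟨ cong₂ _+_ (cong (fsum w) (filterᵇ-cartesianProduct (adj G g) (eqV H h) (verts G) (verts H)))
                 (cong (fsum w) (filterᵇ-cartesianProduct (eqV G g) (adj H h) (verts G) (verts H))) ⟩
  fsum w (cartesianProduct (N G g) (filterᵇ (eqV H h) (verts H)))
    + fsum w (cartesianProduct (filterᵇ (eqV G g) (verts G)) (N H h))
    ≡⟨ cong₂ _+_ (cong (λ hs → fsum w (cartesianProduct (N G g) hs)) H-unique)
                 (cong (λ gs → fsum w (cartesianProduct gs (N H h))) G-unique) ⟩
  fsum w (cartesianProduct (N G g) (h ∷ [])) + fsum w (cartesianProduct (g ∷ []) (N H h))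
    ≡⟨ cong₂ _+_ (fsum-cartesianProduct-singletonʳ w (N G g) h) (fsum-cartesianProduct-singletonˡ w g (N H h)) ⟩
  fsum (λ g′ → w (g′ , h)) (N G g) + fsum (λ h′ → w (g , h′)) (N H h) ∎
  where
  open ≡-Reasoning
  along within : V (G □ H) → Bool
  along  u = adj G g (proj₁ u) ∧ eqV H h (proj₂ u)
  within u = eqV G g (proj₁ u) ∧ adj H h (proj₂ u)
  along∧within≡false : ∀ u → along u ∧ within u ≡ false
  along∧within≡false (g′ , h′) = ∧-∧-disjoint (adj G g g′) (eqV H h h′) (eqV G g g′) (adj H h h′) (disjoint g′)

filterᵇ-finEq-allFin : ∀ {n} (i : Fin n) → filterᵇ (finEq i) (allFin n) ≡ i ∷ []
filterᵇ-finEq-allFin {suc n} zero = begin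
  filterᵇ (finEq zero) (allFin (suc n))                   ≡⟨ cong (filterᵇ (finEq zero)) (allFin-suc n) ⟩
  zero ∷ filterᵇ (finEq zero) (map Fin.suc (allFin n))    ≡⟨ cong (zero ∷_) (filterᵇ-map (finEq zero) Fin.suc (allFin n)) ⟩
  zero ∷ map Fin.suc (filterᵇ (λ _ → false) (allFin n))   ≡⟨ cong (λ js → zero ∷ map Fin.suc js) (filterᵇ-false (allFin n)) ⟩
  zero ∷ []                                               ∎
  where open ≡-Reasoning
filterᵇ-finEq-allFin {suc n} (suc i) = begin
  filterᵇ (finEq (suc i)) (allFin (suc n))            ≡⟨ cong (filterᵇ (finEq (suc i))) (allFin-suc n) ⟩
  filterᵇ (finEq (suc i)) (map Fin.suc (allFin n))    ≡⟨ filterᵇ-finEq-suc i (allFin n) ⟩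
  map Fin.suc (filterᵇ (finEq i) (allFin n))          ≡⟨ cong (map Fin.suc) (filterᵇ-finEq-allFin i) ⟩
  suc i ∷ []                                          ∎
  where
  open ≡-Reasoning
  -- finEq (suc i) (suc j) does not reduce to finEq i j, hence the case split on i ≟ j.
  filterᵇ-finEq-suc : ∀ {n} (i : Fin n) js →
    filterᵇ (finEq (suc i)) (map Fin.suc js) ≡ map Fin.suc (filterᵇ (finEq i) js)
  filterᵇ-finEq-suc i []       = refl
  filterᵇ-finEq-suc i (j ∷ js) with i FinP.≟ j
  ... | yes _ = cong (suc j ∷_) (filterᵇ-finEq-suc i js)
  ... | no  _ = filterᵇ-finEq-suc i js

finEq-adj-disjoint : ∀ {n} (adj : Fin n → Fin n → Bool) → (∀ i → adj i i ≡ false) →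
  ∀ i j → adj i j ∧ finEq i j ≡ false
finEq-adj-disjoint adj irreflexive i j with i FinP.≟ j
... | yes refl = cong (_∧ true) (irreflexive i)
... | no  _    = ∧-zeroʳ (adj i j)

C4-irreflexive : ∀ a → adj C4 a a ≡ false
C4-irreflexive zero                   = refl
C4-irreflexive (suc zero)             = refl
C4-irreflexive (suc (suc zero))       = refl
C4-irreflexive (suc (suc (suc zero))) = refl

fsum-N-C4□P : ∀ n (a : Fin 4) (j : Fin n) (w : V (C4 □ P n) → ℕ) →
  fsum w (N (C4 □ P n) (a , j)) ≡ fsum (λ a′ → w (a′ , j)) (N C4 a) + fsum (λ j′ → w (a , j′)) (N (P n) j)
fsum-N-C4□P n a j = fsum-N-□ C4 (P n) a j (finEq-adj-disjoint (adj C4) C4-irreflexive a)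
  (filterᵇ-finEq-allFin a) (filterᵇ-finEq-allFin j)

below : ℕ → Maybe ℕ
below zero    = nothing
below (suc t) = just t

above : ℕ → ℕ → Maybe ℕ
above n t = if suc t <ᵇ n then just (suc t) else nothing

∈-N-P : ∀ {n} (i j : Fin n) → suc (toℕ i) ≡ toℕ j ⊎ suc (toℕ j) ≡ toℕ i → j ∈ N (P n) i
∈-N-P i j adjacent = ∈-filter⁺ (T? ∘ adj (P _) i) (∈-allFin j)
  (Equivalence.from T-∨ (Sum.map (≡⇒≡ᵇ _ _) (≡⇒≡ᵇ _ _) adjacent))

module _ {n} (j : Fin n) (g : ℕ → ℕ) where

  N-P-member-≤ : ∀ {s} (s<n : s < n) → suc (toℕ j) ≡ s ⊎ suc s ≡ toℕ j →
    g s ≤ fsum (g ∘ toℕ) (N (P n) j)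
  N-P-member-≤ s<n adjacent = subst (_≤ fsum (g ∘ toℕ) (N (P n) j)) (cong g (FinP.toℕ-fromℕ< s<n))
    (∈⇒≤fsum (g ∘ toℕ) (∈-N-P j (fromℕ< s<n)
      (Sum.map (λ e → trans e (sym (FinP.toℕ-fromℕ< s<n))) (trans (cong suc (FinP.toℕ-fromℕ< s<n))) adjacent)))

  N-P-members-≤ : ∀ {r s} (r<n : r < n) (s<n : s < n) → suc r ≡ toℕ j → suc (toℕ j) ≡ s →
    g r + g s ≤ fsum (g ∘ toℕ) (N (P n) j)
  N-P-members-≤ {r} {s} r<n s<n r⋖j j⋖s =
    subst (_≤ fsum (g ∘ toℕ) (N (P n) j)) (cong₂ _+_ (cong g (FinP.toℕ-fromℕ< r<n)) (cong g (FinP.toℕ-fromℕ< s<n)))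
    (∈-∈⇒≤fsum (g ∘ toℕ)
      (∈-N-P j (fromℕ< r<n) (inj₂ (trans (cong suc (FinP.toℕ-fromℕ< r<n)) r⋖j)))
      (∈-N-P j (fromℕ< s<n) (inj₁ (trans j⋖s (sym (FinP.toℕ-fromℕ< s<n)))))
      (λ r≡s → <-irrefl (trans (sym (FinP.toℕ-fromℕ< r<n)) (trans (cong toℕ r≡s) (FinP.toℕ-fromℕ< s<n)))
                        (<-trans (subst (r <_) r⋖j ≤-refl) (subst (toℕ j <_) j⋖s ≤-refl))))

fsum-N-P-≥ : ∀ n (j : Fin n) (g : ℕ → ℕ) →
  maybe g 0 (below (toℕ j)) + maybe g 0 (above n (toℕ j)) ≤ fsum (g ∘ toℕ) (N (P n) j)
fsum-N-P-≥ n j g = go (toℕ j) refl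
  where
  go : ∀ t → toℕ j ≡ t → maybe g 0 (below t) + maybe g 0 (above n t) ≤ fsum (g ∘ toℕ) (N (P n) j)
  go t j≡t with suc t <ᵇ n in has-right
  go zero     j≡t | false = z≤n
  go (suc t′) j≡t | false = subst (_≤ fsum (g ∘ toℕ) (N (P n) j)) (sym (+-identityʳ (g t′)))
    (N-P-member-≤ j g (<-trans (n<1+n t′) (subst (_< n) j≡t (FinP.toℕ<n j))) (inj₂ (sym j≡t)))
  go zero     j≡t | true  =
    N-P-member-≤ j g (<ᵇ⇒< 1 n (Equivalence.from T-≡ has-right)) (inj₁ (cong suc j≡t))
  go (suc t′) j≡t | true  = N-P-members-≤ j g (<-trans (n<1+n t′) (subst (_< n) j≡t (FinP.toℕ<n j)))
    (<ᵇ⇒< (suc (suc t′)) n (Equivalence.from T-≡ has-right)) (sym j≡t) (cong suc j≡t)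

data Column : Set where
  end mid : Column

data Role : Set where
  side hole opposite : Role

nextRole : Role → Role
nextRole side     = side
nextRole hole     = opposite
nextRole opposite = hole

nextRole-involutive : ∀ ρ → nextRole (nextRole ρ) ≡ ρ
nextRole-involutive side     = refl
nextRole-involutive hole     = refl
nextRole-involutive opposite = refl

even : ℕ → Bool
even zero    = true
even (suc t) = not (even t)

role : Bool → Fin 4 → Role
role _     zero                   = side
role true  (suc zero)             = opposite
role false (suc zero)             = hole
role _     (suc (suc zero))       = side
role true  (suc (suc (suc zero))) = hole
role false (suc (suc (suc zero))) = opposite

role-not : ∀ e a → role (not e) a ≡ nextRole (role e a)
role-not _     zero                   = refl
role-not true  (suc zero)             = refl
role-not false (suc zero)             = refl
role-not true  (suc (suc zero))       = refl
role-not false (suc (suc zero))       = refl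
role-not true  (suc (suc (suc zero))) = refl
role-not false (suc (suc (suc zero))) = refl

record Weights : Set where
  constructor weights
  field
    interior endSide endOpposite : ℕ
open Weights

value : Weights → Column → Role → ℕ
value w _   hole     = 0
value w mid _        = interior w
value w end side     = endSide w
value w end opposite = endOpposite w

column : ℕ → ℕ → Column
column n zero    = end
column n (suc t) = if suc (suc t) ≡ᵇ n then end else mid

label : Weights → (n : ℕ) → V (C4 □ P n) → ℕ
label w n (a , j) = value w (column n (toℕ j)) (role (even (toℕ j)) a)

-- A side vertex has the hole and the opposite vertex as its C₄-neighbours;
-- the hole and the opposite vertex have the two side vertices.
acrossExcess : Weights → Column → Role → ℕ
acrossExcess w c side     = value w c opposite ∸ 1
acrossExcess w c hole     = 2 * (value w c side ∸ 1)
acrossExcess w c opposite = 2 * (value w c side ∸ 1)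

fsum-N-C4 : ∀ w c e a → fsum (λ a′ → value w c (role e a′) ∸ 1) (N C4 a) ≡ acrossExcess w c (role e a)
fsum-N-C4 w c true  zero                   = +-identityʳ _
fsum-N-C4 w c false zero                   = +-identityʳ _
fsum-N-C4 w c true  (suc zero)             = refl
fsum-N-C4 w c false (suc zero)             = refl
fsum-N-C4 w c true  (suc (suc zero))       = +-identityʳ _
fsum-N-C4 w c false (suc (suc zero))       = +-identityʳ _
fsum-N-C4 w c true  (suc (suc (suc zero))) = refl
fsum-N-C4 w c false (suc (suc (suc zero))) = refl

record Surroundings : Set where
  constructor _◂_▸_
  field
    left   : Maybe Column
    centre : Column
    right  : Maybe Column
open Surroundings

◂▸-cong : ∀ {l l′ c c′ r r′} → l ≡ l′ → c ≡ c′ → r ≡ r′ → (l ◂ c ▸ r) ≡ (l′ ◂ c′ ▸ r′)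
◂▸-cong refl refl refl = refl

surroundings : ℕ → ℕ → Surroundings
surroundings n t = Maybe.map (column n) (below t) ◂ column n t ▸ Maybe.map (column n) (above n t)

verticalExcess : Weights → Maybe Column → Role → ℕ
verticalExcess w nothing  ρ = 0
verticalExcess w (just c) ρ = value w c (nextRole ρ) ∸ 1

excess : Weights → Surroundings → Role → ℕ
excess w (l ◂ c ▸ r) ρ = value w c ρ + acrossExcess w c ρ + (verticalExcess w l ρ + verticalExcess w r ρ)

slots : List Surroundings
slots = (nothing  ◂ end ▸ just mid)
      ∷ (just end ◂ mid ▸ just mid)
      ∷ (just mid ◂ mid ▸ just mid)
      ∷ (just mid ◂ mid ▸ just end)
      ∷ (just mid ◂ end ▸ nothing)
      ∷ []

<⇒≡ᵇ≡false : ∀ {m n} → m < n → (m ≡ᵇ n) ≡ false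
<⇒≡ᵇ≡false {zero}  {suc n} _         = refl
<⇒≡ᵇ≡false {suc m} {suc n} (s≤s m<n) = <⇒≡ᵇ≡false m<n

column-mid : ∀ {n t} → 0 < t → suc t < n → column n t ≡ mid
column-mid {n} {suc t} _ t<n = cong (if_then end else mid) (<⇒≡ᵇ≡false t<n)

column-last : ∀ {n t} → suc t ≡ n → column n t ≡ end
column-last {t = zero}  _    = refl
column-last {t = suc t} refl = cong (if_then end else mid) (Equivalence.to T-≡ (≡⇒≡ᵇ t t refl))

above-< : ∀ {n t} → suc t < n → above n t ≡ just (suc t)
above-< {t = t} t<n = cong (if_then just (suc t) else nothing) (Equivalence.to T-≡ (<⇒<ᵇ t<n))

above-last : ∀ {n t} → suc t ≡ n → above n t ≡ nothing
above-last {t = t} refl = cong (if_then just (suc t) else nothing) (<ᵇ-irrefl t)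
  where
  <ᵇ-irrefl : ∀ m → (m <ᵇ m) ≡ false
  <ᵇ-irrefl zero    = refl
  <ᵇ-irrefl (suc m) = <ᵇ-irrefl m

surroundings-∈-slots : ∀ {n t} → 4 ≤ n → t < n → surroundings n t ∈ slots
surroundings-∈-slots {t = zero}     (s≤s (s≤s (s≤s (s≤s _)))) _ = here refl
surroundings-∈-slots {t = suc zero} (s≤s (s≤s (s≤s (s≤s _)))) _ = there (here refl)
surroundings-∈-slots {n} {suc (suc t)} _ t<n with m≤n⇒m<n∨m≡n t<n
... | inj₂ last = subst (_∈ slots)
        (sym (◂▸-cong (cong just (column-mid z<s t<n)) (column-last last)
                      (cong (Maybe.map (column n)) (above-last last))))
        (there (there (there (there (here refl)))))
... | inj₁ t+1<n with m≤n⇒m<n∨m≡n t+1<n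
...   | inj₂ penultimate = subst (_∈ slots)
        (sym (◂▸-cong (cong just (column-mid z<s t<n)) (column-mid z<s t+1<n)
                      (trans (cong (Maybe.map (column n)) (above-< t+1<n)) (cong just (column-last penultimate)))))
        (there (there (there (here refl))))
...   | inj₁ t+2<n = subst (_∈ slots)
        (sym (◂▸-cong (cong just (column-mid z<s t<n)) (column-mid z<s t+1<n)
                      (trans (cong (Maybe.map (column n)) (above-< t+1<n)) (cong just (column-mid z<s t+2<n)))))
        (there (there (here refl)))

module _ (w : Weights) (n : ℕ) (a : Fin 4) where

  private
    excessAt : ℕ → ℕ
    excessAt t = value w (column n t) (role (even t) a) ∸ 1

  below-verticalExcess : ∀ t →
    verticalExcess w (Maybe.map (column n) (below t)) (role (even t) a) ≡ maybe excessAt 0 (below t)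
  below-verticalExcess zero    = refl
  below-verticalExcess (suc t) = cong (λ ρ → value w (column n t) ρ ∸ 1)
    (trans (cong nextRole (role-not (even t) a)) (nextRole-involutive _))

  above-verticalExcess : ∀ t →
    verticalExcess w (Maybe.map (column n) (above n t)) (role (even t) a) ≡ maybe excessAt 0 (above n t)
  above-verticalExcess t with suc t <ᵇ n
  ... | false = refl
  ... | true  = cong (λ ρ → value w (column n (suc t)) ρ ∸ 1) (sym (role-not (even t) a))

  verticalExcess-≤ : (j : Fin n) →
    let σ = surroundings n (toℕ j) ; ρ = role (even (toℕ j)) a in
    verticalExcess w (left σ) ρ + verticalExcess w (right σ) ρ
      ≤ fsum (λ j′ → label w n (a , j′) ∸ 1) (N (P n) j)
  verticalExcess-≤ j = subst (_≤ fsum (λ j′ → label w n (a , j′) ∸ 1) (N (P n) j))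
    (sym (cong₂ _+_ (below-verticalExcess (toℕ j)) (above-verticalExcess (toℕ j))))
    (fsum-N-P-≥ n j excessAt)

Dominating : ℕ → Weights → Set
Dominating k w = All (λ σ → ∀ ρ → value w (centre σ) ρ < k → k ≤ excess w σ ρ) slots

value-≤ : ∀ {b} w → interior w ≤ b → endSide w ≤ b → endOpposite w ≤ b → ∀ c ρ → value w c ρ ≤ b
value-≤ w i≤ s≤ o≤ c   hole     = z≤n
value-≤ w i≤ s≤ o≤ mid side     = i≤
value-≤ w i≤ s≤ o≤ mid opposite = i≤
value-≤ w i≤ s≤ o≤ end side     = s≤
value-≤ w i≤ s≤ o≤ end opposite = o≤

label-isKRDF : ∀ k w n → 4 ≤ n → interior w ≤ suc k → endSide w ≤ suc k → endOpposite w ≤ suc k →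
  Dominating k w → IsKRDF k (C4 □ P n) (label w n)
label-isKRDF k w n 4≤n i≤ s≤ o≤ dominating =
  (λ { (a , j) → value-≤ w i≤ s≤ o≤ (column n (toℕ j)) (role (even (toℕ j)) a) }) ,
  (λ { (a , j) fv<k → ≤-fsum-pred⇒KRDF-condition k (C4 □ P n) (label w n) (a , j) (local a j fv<k) })
  where
  local : ∀ a j → label w n (a , j) < k →
    k ≤ label w n (a , j) + fsum (λ u → label w n u ∸ 1) (N (C4 □ P n) (a , j))
  local a j fv<k = begin
    k                                               ≤⟨ All.lookup dominating (surroundings-∈-slots 4≤n (FinP.toℕ<n j)) ρ fv<k ⟩
    excess w σ ρ                                    ≤⟨ +-monoʳ-≤ (value w c ρ + acrossExcess w c ρ) (verticalExcess-≤ w n a j) ⟩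
    value w c ρ + acrossExcess w c ρ + Σvertical    ≡⟨ +-assoc (value w c ρ) _ _ ⟩
    value w c ρ + (acrossExcess w c ρ + Σvertical)  ≡⟨ cong (λ s → value w c ρ + (s + Σvertical)) (sym (fsum-N-C4 w c e a)) ⟩
    value w c ρ + (Σacross + Σvertical)             ≡⟨ cong (value w c ρ +_) (sym (fsum-N-C4□P n a j (λ u → label w n u ∸ 1))) ⟩
    label w n (a , j) + fsum (λ u → label w n u ∸ 1) (N (C4 □ P n) (a , j)) ∎
    where
    open ≤-Reasoning
    t = toℕ j
    e = even t
    c = column n t
    ρ = role e a
    σ = surroundings n t
    Σacross   = fsum (λ a′ → label w n (a′ , j) ∸ 1) (N C4 a)
    Σvertical = fsum (λ j′ → label w n (a , j′) ∸ 1) (N (P n) j)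

columnWeight : Weights → Column → ℕ
columnWeight w mid = 3 * interior w
columnWeight w end = 2 * endSide w + endOpposite w

fsum-column : ∀ w c e → fsum (λ a → value w c (role e a)) (allFin 4) ≡ columnWeight w c
fsum-column w mid true  = refl
fsum-column w mid false = refl
fsum-column w end true  = rearrange (endSide w) (endOpposite w)
  where
  rearrange : ∀ x y → x + (y + (x + 0)) ≡ 2 * x + y
  rearrange = solve-∀
fsum-column w end false = rearrange (endSide w) (endOpposite w)
  where
  rearrange : ∀ x y → x + (x + (y + 0)) ≡ 2 * x + y
  rearrange = solve-∀

label-weight : ∀ w m → weight (C4 □ P (2 + m)) (label w (2 + m)) ≡ 3 * m * interior w + 2 * columnWeight w end
label-weight w m = begin
  fsum f (cartesianProduct (allFin 4) (allFin n))
    ≡⟨ fsum-cartesianProduct f (allFin 4) (allFin n) ⟩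
  fsum (λ a → fsum (λ j → f (a , j)) (allFin n)) (allFin 4)
    ≡⟨ fsum-comm (λ a j → f (a , j)) (allFin 4) (allFin n) ⟩
  fsum (λ j → fsum (λ a → f (a , j)) (allFin 4)) (allFin n)
    ≡⟨ fsum-cong (λ j → fsum-column w (column n (toℕ j)) (even (toℕ j))) (allFin n) ⟩
  fsum (λ j → columnWeight w (column n (toℕ j))) (allFin n)
    ≡⟨ fsum-allFin n (columnWeight w ∘ column n) ⟩
  columnWeight w end + sum (applyUpTo (columnWeight w ∘ column n ∘ suc) (suc m))
    ≡⟨ cong (columnWeight w end +_) (sum-applyUpTo-last m _
          (λ t t<m → cong (columnWeight w) (column-mid z<s (s<s (s<s t<m))))
          (cong (columnWeight w) (column-last {t = suc m} refl))) ⟩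
  columnWeight w end + (m * columnWeight w mid + columnWeight w end)
    ≡⟨ rearrange (columnWeight w end) m (interior w) ⟩
  3 * m * interior w + 2 * columnWeight w end ∎
  where
  open ≡-Reasoning
  n = 2 + m
  f = label w n
  rearrange : ∀ E m A → E + (m * (3 * A) + E) ≡ 3 * m * A + 2 * E
  rearrange = solve-∀

4*stripBound≤closedForm : ∀ m k A b c → 12 * A ≤ 3 * k + 24 → 4 * (b + c) ≤ 11 * k + 80 →
  4 * (3 * m * A + b + c) ≤ 3 * (2 + m) * k + 5 * k + 24 * (2 + m) + 32
4*stripBound≤closedForm m k A b c interior≤ ends≤ = begin
  4 * (3 * m * A + b + c)          ≡⟨ expand m A b c ⟩
  m * (12 * A) + 4 * (b + c)       ≤⟨ +-mono-≤ (*-monoʳ-≤ m interior≤) ends≤ ⟩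
  m * (3 * k + 24) + (11 * k + 80) ≡⟨ collect m k ⟩
  3 * (2 + m) * k + 5 * k + 24 * (2 + m) + 32 ∎
  where
  open ≤-Reasoning
  expand : ∀ m A b c → 4 * (3 * m * A + b + c) ≡ m * (12 * A) + 4 * (b + c)
  expand = solve-∀
  collect : ∀ m k → m * (3 * k + 24) + (11 * k + 80) ≡ 3 * (2 + m) * k + 5 * k + 24 * (2 + m) + 32
  collect = solve-∀

∀-Role? : {Q : Role → Set} → (∀ ρ → Dec (Q ρ)) → Dec (∀ ρ → Q ρ)
∀-Role? Q? = map′ (λ { (s , h , o) side → s ; (s , h , o) hole → h ; (s , h , o) opposite → o })
                  (λ q → q side , q hole , q opposite)
                  (Q? side ×-dec Q? hole ×-dec Q? opposite)

dominating? : ∀ k w → Dec (Dominating k w)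
dominating? k w = All.all? (λ σ → ∀-Role? (λ ρ → value w (centre σ) ρ <? k →-dec k ≤? excess w σ ρ)) slots

StripFits : ℕ → Weights → Set
StripFits k w = (interior w ≤ suc k × endSide w ≤ suc k × endOpposite w ≤ suc k)
              × Dominating k w
              × 2 * columnWeight w end ≤ 6 * B′ k + 2 * C′ k

stripFits? : ∀ k w → Dec (StripFits k w)
stripFits? k w = (interior w ≤? suc k ×-dec endSide w ≤? suc k ×-dec endOpposite w ≤? suc k)
           ×-dec dominating? k w
           ×-dec 2 * columnWeight w end ≤? 6 * B′ k + 2 * C′ k

ClosedFormBound : ℕ → Set
ClosedFormBound k = 12 * A′ k ≤ 3 * k + 24 × 4 * (6 * B′ k + 2 * C′ k) ≤ 11 * k + 80

closedFormBound? : ∀ k → Dec (ClosedFormBound k)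
closedFormBound? k = 12 * A′ k ≤? 3 * k + 24 ×-dec 4 * (6 * B′ k + 2 * C′ k) ≤? 11 * k + 80

Allowed : ℕ → Set
Allowed k = 1 ≤ k × k ≢ 1 × k ≢ 8 × k ≢ 11 × k ≢ 12

allowed? : ∀ k → Dec (Allowed k)
allowed? k = 1 ≤? k ×-dec ¬? (k ≟ 1) ×-dec ¬? (k ≟ 8) ×-dec ¬? (k ≟ 11) ×-dec ¬? (k ≟ 12)

-- End-column values (side, opposite); the default is never used for an allowed k.
endWeights : ℕ → ℕ × ℕ
endWeights 2  = 2 , 0
endWeights 3  = 2 , 1
endWeights 4  = 3 , 2
endWeights 5  = 3 , 1
endWeights 6  = 3 , 2
endWeights 7  = 4 , 2
endWeights 9  = 4 , 3
endWeights 10 = 5 , 3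
endWeights 13 = 6 , 4
endWeights _  = 0 , 0

stripWeights : ℕ → Weights
stripWeights k = weights (A′ k) (proj₁ (endWeights k)) (proj₂ (endWeights k))

stripWeights-fit : ∀ {k} → k < 14 → Allowed k → StripFits k (stripWeights k) × ClosedFormBound k
stripWeights-fit = toWitness
  {a? = allUpTo? (λ k → allowed? k →-dec stripFits? k (stripWeights k) ×-dec closedFormBound? k) 14} _

mainTheorem20 : (n k : ℕ) → 4 ≤ n → 1 ≤ k → k ≤ 13 →
    k ≢ 1 → k ≢ 8 → k ≢ 11 → k ≢ 12 →
    γkR≤ k (C4 □ P n) (bound n k)
      × 4 * bound n k ≤ 3 * n * k + 5 * k + 24 * n + 32
mainTheorem20 zero       k ()
mainTheorem20 (suc zero) k (s≤s ())
mainTheorem20 n@(suc (suc m)) k 4≤n 1≤k k≤13 k≢1 k≢8 k≢11 k≢12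
  with stripWeights-fit (s≤s k≤13) (1≤k , k≢1 , k≢8 , k≢11 , k≢12)
... | ((i≤ , s≤ , o≤) , dominating , ends≤) , interior-growth , ends-growth =
  (label w n , label-isKRDF k w n 4≤n i≤ s≤ o≤ dominating , weight≤bound) ,
  4*stripBound≤closedForm m k (A′ k) (6 * B′ k) (2 * C′ k) interior-growth ends-growth
  where
  w = stripWeights k
  weight≤bound : weight (C4 □ P n) (label w n) ≤ bound n k
  weight≤bound = begin
    weight (C4 □ P n) (label w n)            ≡⟨ label-weight w m ⟩
    3 * m * A′ k + 2 * columnWeight w end    ≤⟨ +-monoʳ-≤ (3 * m * A′ k) ends≤ ⟩
    3 * m * A′ k + (6 * B′ k + 2 * C′ k)     ≡⟨ sym (+-assoc (3 * m * A′ k) _ _) ⟩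
    bound n k                                ∎
    where open ≤-Reasoning
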